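{- Let $\mathcal{A}$ be an $\mathbf{HpsUL}^\ast_\omega$-chain. Then for all $s,t,u\in A$: (i) $st>u$ iff $t>s\backslash u$ iff $s>u/t$; (ii) $su>tu$ implies $s>t$; (iii) $stu=u$ implies $tu=u$.
   Context: An $\mathbf{HpsUL}$-algebra is an algebra $\mathcal{A}=\langle A,\wedge,\vee,\cdot,\backslash,/,e,f,\bot,\top\rangle$ such that: $\langle A,\wedge,\vee,\bot,\top\rangle$ is a bounded lattice; $\langle A,\cdot,e\rangle$ is a monoid; $xy\le z$ iff $x\le z/y$ iff $y\le x\backslash z$; and $\lambda_u((x\vee y)\backslash x)\vee\rho_v((x\vee y)\backslash y)=e$ for all $x,y,u,v$, where $\lambda_a(b)=(a\backslash(ba))\wedge e$, $\rho_a(b)=((ab)/a)\wedge e$. An $\mathbf{HpsUL}^\ast$-algebra is an $\mathbf{HpsUL}$-algebra satisfying: $xy\le e$ implies $yx\le e$. An $\mathbf{HpsUL}^\ast_\omega$-algebra is an $\mathbf{HpsUL}^\ast$-algebra satisfying $x\backslash e=x^2\backslash e$ for all $x$. A chain is one whose lattice order is linear. -}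

module Defs where

open import Level using (Level; suc; _⊔_)
open import Relation.Binary.PropositionalEquality using (_≡_)
open import Relation.Nullary using (¬_)
open import Data.Product using (_×_)
open import Data.Sum using (_⊎_)
open import Function.Bundles using (_⇔_)

record RLSig (a : Level) : Set (suc a) where
  infixl 8 _·_
  infixr 7 _＼_
  infixl 7 _／_
  infixr 6 _∧_
  infixr 5 _∨_
  infix 4 _≤_ _<_ _>_
  field
    Carrier : Set a
    _∧_ _∨_ _·_ _＼_ _／_ : Carrier → Carrier → Carrier
    e f ⊥ ⊤ : Carrier

  _≤_ : Carrier → Carrier → Set a
  x ≤ y = x ∧ y ≡ x

  _<_ : Carrier → Carrier → Set a
  x < y = x ≤ y × ¬ (x ≡ y)

  _>_ : Carrier → Carrier → Set a
  x > y = y < x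

  λ[_] : Carrier → Carrier → Carrier
  λ[ a ] b = (a ＼ (b · a)) ∧ e

  ρ[_] : Carrier → Carrier → Carrier
  ρ[ a ] b = ((a · b) ／ a) ∧ e

record IsHpsUL {a : Level} (S : RLSig a) : Set a where
  open RLSig S
  field
    ∧-comm   : ∀ x y → x ∧ y ≡ y ∧ x
    ∨-comm   : ∀ x y → x ∨ y ≡ y ∨ x
    ∧-assoc  : ∀ x y z → (x ∧ y) ∧ z ≡ x ∧ (y ∧ z)
    ∨-assoc  : ∀ x y z → (x ∨ y) ∨ z ≡ x ∨ (y ∨ z)
    ∧-absorb : ∀ x y → x ∧ (x ∨ y) ≡ x
    ∨-absorb : ∀ x y → x ∨ (x ∧ y) ≡ x
    ⊥-least  : ∀ x → ⊥ ≤ x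
    ⊤-great  : ∀ x → x ≤ ⊤
    ·-assoc  : ∀ x y z → (x · y) · z ≡ x · (y · z)
    e-identˡ : ∀ x → e · x ≡ x
    e-identʳ : ∀ x → x · e ≡ x
    resid-／ : ∀ x y z → (x · y ≤ z) ⇔ (x ≤ z ／ y)
    resid-＼ : ∀ x y z → (x · y ≤ z) ⇔ (y ≤ x ＼ z)
    psl : ∀ x y u v →
      λ[ u ] ((x ∨ y) ＼ x) ∨ ρ[ v ] ((x ∨ y) ＼ y) ≡ e

record IsHpsUL* {a : Level} (S : RLSig a) : Set a where
  open RLSig S
  field
    isHpsUL : IsHpsUL S
    e-cyclic : ∀ x y → x · y ≤ e → y · x ≤ e

record IsHpsUL*ω {a : Level} (S : RLSig a) : Set a where
  open RLSig S
  field
    isHpsUL* : IsHpsUL* S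
    ω-law : ∀ x → x ＼ e ≡ (x · x) ＼ e

IsChain : {a : Level} → RLSig a → Set a
IsChain S = ∀ x y → x ≤ y ⊎ y ≤ x
  where open RLSig S

-- For (iii): put a = s·t·s and b = t·s·t, so that a·(t·u) = u and b·u = t·u.
-- In an HpsUL*ω-algebra x·y ≤ e ⇔ y·x ≤ e ⇔ x·y·x ≤ e, hence a ≤ e ⇔ b ≤ e.
-- In a chain each of a, b lies below or above e, and every case squeezes t·u
-- and u against each other. Parts (i) and (ii) are residuation and
-- monotonicity of multiplication, contraposed using linearity.
module Submission where

open import Defs
open import Level using (Level)
open import Relation.Binary.PropositionalEquality using (_≡_; refl; sym; trans; cong; subst; module ≡-Reasoning)
open import Data.Product using (_×_; _,_)
open import Data.Sum using (inj₁; inj₂)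
open import Data.Empty using (⊥-elim)
open import Relation.Nullary using (¬_)
open import Function.Bundles using (_⇔_; mk⇔; Equivalence)
open import Function.Properties.Equivalence using () renaming (trans to ⇔-trans; sym to ⇔-sym)

open Equivalence using (to; from)

module HpsULProperties {a : Level} {S : RLSig a} (H : IsHpsUL S) where
  open RLSig S
  open IsHpsUL H

  ≤-refl : ∀ x → x ≤ x
  ≤-refl x = trans (cong (x ∧_) (sym (∨-absorb x x))) (∧-absorb x (x ∧ x))

  ≤-trans : ∀ {x y z} → x ≤ y → y ≤ z → x ≤ z
  ≤-trans {x} {y} {z} x≤y y≤z = begin
    x ∧ z         ≡⟨ cong (_∧ z) (sym x≤y) ⟩
    (x ∧ y) ∧ z   ≡⟨ ∧-assoc x y z ⟩
    x ∧ (y ∧ z)   ≡⟨ cong (x ∧_) y≤z ⟩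
    x ∧ y         ≡⟨ x≤y ⟩
    x             ∎
    where open ≡-Reasoning

  ≤-antisym : ∀ {x y} → x ≤ y → y ≤ x → x ≡ y
  ≤-antisym {x} {y} x≤y y≤x = trans (sym x≤y) (trans (∧-comm x y) y≤x)

  ≤-respˡ-≡ : ∀ {x y z} → x ≡ y → x ≤ z → y ≤ z
  ≤-respˡ-≡ refl x≤z = x≤z

  ≤-respʳ-≡ : ∀ {x y z} → y ≡ z → x ≤ y → x ≤ z
  ≤-respʳ-≡ refl x≤y = x≤y

  ·-monoˡ-≤ : ∀ {x y} z → x ≤ y → x · z ≤ y · z
  ·-monoˡ-≤ {x} {y} z x≤y =
    from (resid-／ x z (y · z)) (≤-trans x≤y (to (resid-／ y z (y · z)) (≤-refl _)))

  ≤e⇒·-decreasing : ∀ {x} y → x ≤ e → x · y ≤ y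
  ≤e⇒·-decreasing y x≤e = ≤-respʳ-≡ (e-identˡ y) (·-monoˡ-≤ y x≤e)

  e≤⇒·-increasing : ∀ {x} y → e ≤ x → y ≤ x · y
  e≤⇒·-increasing y e≤x = ≤-respˡ-≡ (e-identˡ y) (·-monoˡ-≤ y e≤x)

  ·≤＼⇔·≤／ : ∀ x y z → (y ≤ x ＼ z) ⇔ (x ≤ z ／ y)
  ·≤＼⇔·≤／ x y z = ⇔-trans (⇔-sym (resid-＼ x y z)) (resid-／ x y z)

  <⇒≱ : ∀ {x y} → x > y → ¬ (x ≤ y)
  <⇒≱ (y≤x , y≢x) x≤y = y≢x (≤-antisym y≤x x≤y)

module ChainProperties {a : Level} {S : RLSig a} (H : IsHpsUL S) (C : IsChain S) where
  open RLSig S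
  open HpsULProperties H

  ≰⇒> : ∀ {x y} → ¬ (x ≤ y) → x > y
  ≰⇒> {x} {y} x≰y with C x y
  ... | inj₁ x≤y = ⊥-elim (x≰y x≤y)
  ... | inj₂ y≤x = y≤x , λ y≡x → x≰y (subst (x ≤_) (sym y≡x) (≤-refl x))

  ≤⇔≤⇒>⇔> : ∀ {x y z w} → (x ≤ y ⇔ z ≤ w) → (x > y) ⇔ (z > w)
  ≤⇔≤⇒>⇔> x≤y⇔z≤w =
    mk⇔ (λ x>y → ≰⇒> (λ z≤w → <⇒≱ x>y (from x≤y⇔z≤w z≤w)))
        (λ z>w → ≰⇒> (λ x≤y → <⇒≱ z>w (to x≤y⇔z≤w x≤y)))

  monotone-reflects-> : ∀ (g : Carrier → Carrier) → (∀ {x y} → x ≤ y → g x ≤ g y) →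
                        ∀ {x y} → g x > g y → x > y
  monotone-reflects-> g g-mono gx>gy = ≰⇒> (λ x≤y → <⇒≱ gx>gy (g-mono x≤y))

module HpsUL*ωProperties {a : Level} {S : RLSig a} (H : IsHpsUL*ω S) where
  open RLSig S
  open IsHpsUL*ω H
  open IsHpsUL* isHpsUL*
  open IsHpsUL isHpsUL
  open HpsULProperties isHpsUL

  ·≤e-comm : ∀ x y → (x · y ≤ e) ⇔ (y · x ≤ e)
  ·≤e-comm x y = mk⇔ (e-cyclic x y) (e-cyclic y x)

  ·≤e⇔square·≤e : ∀ x y → (x · y ≤ e) ⇔ (x · x · y ≤ e)
  ·≤e⇔square·≤e x y =
    ⇔-trans (resid-＼ x y e)
      (⇔-trans (mk⇔ (subst (y ≤_) (ω-law x)) (subst (y ≤_) (sym (ω-law x))))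
        (⇔-sym (resid-＼ (x · x) y e)))

  sandwich≤e⇔·≤e : ∀ x y → (x · y · x ≤ e) ⇔ (x · y ≤ e)
  sandwich≤e⇔·≤e x y =
    ⇔-trans (·≤e-comm (x · y) x)
      (⇔-trans (mk⇔ (≤-respˡ-≡ (sym (·-assoc x x y))) (≤-respˡ-≡ (·-assoc x x y)))
        (⇔-sym (·≤e⇔square·≤e x y)))

  sandwich≤e-swap : ∀ s t → (s · t · s ≤ e) ⇔ (t · s · t ≤ e)
  sandwich≤e-swap s t =
    ⇔-trans (sandwich≤e⇔·≤e s t)
      (⇔-trans (·≤e-comm s t) (⇔-sym (sandwich≤e⇔·≤e t s)))

  module _ (C : IsChain S) where

    ·-fixed-cancelˡ : ∀ s t u → s · t · u ≡ u → t · u ≡ u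
    ·-fixed-cancelˡ s t u stu≡u = ≤-antisym tu≤u u≤tu
      where
      open ≡-Reasoning
      tst·u≡tu : t · s · t · u ≡ t · u
      tst·u≡tu = begin
        t · s · t · u     ≡⟨ ·-assoc (t · s) t u ⟩
        t · s · (t · u)   ≡⟨ ·-assoc t s (t · u) ⟩
        t · (s · (t · u)) ≡⟨ cong (t ·_) (sym (·-assoc s t u)) ⟩
        t · (s · t · u)   ≡⟨ cong (t ·_) stu≡u ⟩
        t · u             ∎
      sts·tu≡u : s · t · s · (t · u) ≡ u
      sts·tu≡u = begin
        s · t · s · (t · u)   ≡⟨ ·-assoc (s · t) s (t · u) ⟩
        s · t · (s · (t · u)) ≡⟨ cong (s · t ·_) (sym (·-assoc s t u)) ⟩
        s · t · (s · t · u)   ≡⟨ cong (s · t ·_) stu≡u ⟩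
        s · t · u             ≡⟨ stu≡u ⟩
        u                     ∎
      tu≤u : t · u ≤ u
      tu≤u with C (s · t · s) e
      ... | inj₁ sts≤e = ≤-respˡ-≡ tst·u≡tu
                           (≤e⇒·-decreasing u (to (sandwich≤e-swap s t) sts≤e))
      ... | inj₂ e≤sts = ≤-respʳ-≡ sts·tu≡u (e≤⇒·-increasing (t · u) e≤sts)
      u≤tu : u ≤ t · u
      u≤tu with C (t · s · t) e
      ... | inj₁ tst≤e = ≤-respˡ-≡ sts·tu≡u
                           (≤e⇒·-decreasing (t · u) (from (sandwich≤e-swap s t) tst≤e))
      ... | inj₂ e≤tst = ≤-respʳ-≡ tst·u≡tu (e≤⇒·-increasing u e≤tst)

lemma2p5 : {a : Level} (S : RLSig a) → IsHpsUL*ω S → IsChain S →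
    let open RLSig S in
    ∀ (s t u : Carrier) →
      (((s · t > u) ⇔ (t > s ＼ u)) × ((t > s ＼ u) ⇔ (s > u ／ t)))
      × ((s · u > t · u) → s > t)
      × ((s · t · u ≡ u) → t · u ≡ u)
lemma2p5 S H C s t u =
  ( ≤⇔≤⇒>⇔> (resid-＼ s t u) , ≤⇔≤⇒>⇔> (·≤＼⇔·≤／ s t u) )
  , monotone-reflects-> (_· u) (·-monoˡ-≤ u)
  , ·-fixed-cancelˡ C s t u
  where
  open RLSig S
  hpsUL : IsHpsUL S
  hpsUL = IsHpsUL*.isHpsUL (IsHpsUL*ω.isHpsUL* H)
  open IsHpsUL hpsUL using (resid-＼)
  open HpsULProperties hpsUL
  open ChainProperties hpsUL C
  open HpsUL*ωProperties H
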